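{- Let $B$ be a finite set of permutations and let $\|B\|_\infty$ denote the maximum length of a permutation in $B$. Let $\pi\in S_k$, $r\in[k]$, and suppose that $\pi(r)$ is an ES$^+$-reducible entry of $\pi$ with respect to $B$. Then every basis vector $\mathbf{b}$ of $\mathcal{G}_r(\pi)$ satisfies $\|\mathbf{b}\|\le\|B\|_\infty-1$.
   Context: Permutations are written in one-line notation; $\operatorname{st}(w)$ of a sequence $w$ of distinct natural numbers is the unique permutation order isomorphic to $w$. A permutation contains $\beta$ if it has a subsequence order isomorphic to $\beta$, and avoids $\beta$ otherwise. For $\pi\in S_k$ and $\mathbf{g}=(g_1,\dots,g_{k+1})\in\mathbb{N}^{k+1}$ with $\|\mathbf{g}\|=g_1+\cdots+g_{k+1}$, let $Z(B;\pi;\mathbf{g})$ be the set of permutations $p$ of length $k+\|\mathbf{g}\|$ avoiding every element of $B$ such that $p(g_1+\cdots+g_i+i)=\pi(i)$ for $i=1,\dots,k$. For $r\in[k]$, $d_r(\pi)=\operatorname{st}(\pi \text{ with the entry }\pi(r)\text{ deleted})$ and $d_r(\mathbf{g})=(g_1,\dots,g_{r-1},g_r+g_{r+1},g_{r+2},\dots,g_{k+1})$. The entry $\pi(r)$ is ES$^+$-reducible for $\pi$ with respect to $B$ if $|Z(B;\pi;\mathbf{g})|=|Z(B;d_r(\pi);d_r(\mathbf{g}))|$ whenever $Z(B;\pi;\mathbf{g})\neq\emptyset$. Order $\mathbb{N}^{k+1}$ by the product order ($\mathbf{x}\le\mathbf{y}$ iff $x_i\le y_i$ for all $i$). Define $\mathcal{G}_r(\pi)=\{\mathbf{g}\in\mathbb{N}^{k+1}: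 \text{for all }\mathbf{h}\le\mathbf{g},\ Z(B;\pi;\mathbf{h})\neq\emptyset\text{ or }Z(B;d_r(\pi);d_r(\mathbf{h}))=\emptyset\}$, a lower order ideal. Its basis is the set of minimal elements (in the product order) of $\mathbb{N}^{k+1}\setminus\mathcal{G}_r(\pi)$. -}

module Defs where

open import Data.Nat using (ℕ; zero; suc; _+_; _∸_; _≤_; _<_; _<?_; _⊔_)
import Data.Nat as ℕ
open import Data.Bool using (Bool; true; false)
open import Data.List using (List; []; _∷_; length; map; filter; take; upTo; concatMap)
open import Data.Nat.ListAction using (sum)
import Data.List.Properties as LP
import Data.Maybe.Properties as MP
open import Data.Maybe using (Maybe; just; nothing)
open import Data.Vec using (Vec; toList)
open import Data.Vec.Relation.Binary.Pointwise.Inductive using (Pointwise)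
open import Data.List.Relation.Unary.All using (All) renaming (all? to All?)
open import Data.List.Relation.Unary.Any using (Any) renaming (any? to Any?)
open import Data.List.Relation.Unary.Unique.Propositional using (Unique)
open import Data.List.Relation.Unary.Unique.DecPropositional ℕ._≟_ using (unique?)
open import Data.Product using (_×_; _,_)
open import Data.Sum using (_⊎_)
open import Relation.Binary.PropositionalEquality using (_≡_)
open import Relation.Nullary using (¬_; Dec; yes; no)
open import Relation.Nullary.Decidable using (_×-dec_; ¬?)

-- Permutations in one-line notation are lists of naturals.

IsPerm : ℕ → List ℕ → Set
IsPerm n w = length w ≡ n × Unique w × All (λ x → 1 ≤ x × x ≤ n) w

IsPermutation : List ℕ → Set
IsPermutation w = IsPerm (length w) w

words : ℕ → List ℕ → List (List ℕ)
words zero    xs = [] ∷ []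
words (suc n) xs = concatMap (λ x → map (x ∷_) (words n xs)) xs

allPerms : ℕ → List (List ℕ)
allPerms n = filter unique? (words n (map suc (upTo n)))

st : List ℕ → List ℕ
st w = map (λ x → suc (length (filter (_<? x) w))) w

subseqs : List ℕ → List (List ℕ)
subseqs []       = [] ∷ []
subseqs (x ∷ xs) = map (x ∷_) (subseqs xs) Data.List.++ subseqs xs

Contains : List ℕ → List ℕ → Set
Contains p β = Any (λ s → st s ≡ β) (subseqs p)

Avoids : List ℕ → List (List ℕ) → Set
Avoids p B = All (λ β → ¬ Contains p β) B

at : List ℕ → ℕ → Maybe ℕ
at []       _       = nothing
at (x ∷ xs) zero    = just x
at (x ∷ xs) (suc i) = at xs i

-- p(g_1+…+g_i+i) = π(i) for i = 1..k  (written 0-indexed: i' = i-1,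
-- 0-indexed position g_1+…+g_{i'+1} + i')
Fits : List ℕ → List ℕ → List ℕ → Set
Fits π g p = All (λ i → at p (sum (take (suc i) g) + i) ≡ at π i) (upTo (length π))

InZ : List (List ℕ) → List ℕ → List ℕ → List ℕ → Set
InZ B π g p = Avoids p B × Fits π g p

InZ? : (B : List (List ℕ)) (π g : List ℕ) (p : List ℕ) → Dec (InZ B π g p)
InZ? B π g p =
  All? (λ β → ¬? (Any? (λ s → LP.≡-dec ℕ._≟_ (st s) β) (subseqs p))) B
  ×-dec All? (λ i → MP.≡-dec ℕ._≟_ (at p (sum (take (suc i) g) + i)) (at π i)) (upTo (length π))

Zcard : List (List ℕ) → List ℕ → List ℕ → ℕ
Zcard B π g = length (filter (InZ? B π g) (allPerms (length π + sum g)))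

deleteAt : ℕ → List ℕ → List ℕ
deleteAt _       []       = []
deleteAt zero    (x ∷ xs) = xs
deleteAt (suc i) (x ∷ xs) = x ∷ deleteAt i xs

mergeAt : ℕ → List ℕ → List ℕ
mergeAt zero    (a ∷ b ∷ xs) = (a + b) ∷ xs
mergeAt (suc i) (a ∷ xs)     = a ∷ mergeAt i xs
mergeAt _       xs           = xs

-- d_r for r ∈ [k] (1-indexed, as in the paper)
dπ : ℕ → List ℕ → List ℕ
dπ r π = st (deleteAt (r ∸ 1) π)

dg : ℕ → List ℕ → List ℕ
dg r g = mergeAt (r ∸ 1) g

ESReducible : List (List ℕ) → (k : ℕ) → List ℕ → ℕ → Set
ESReducible B k π r = (g : Vec ℕ (suc k)) → ¬ (Zcard B π (toList g) ≡ 0) →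
  Zcard B π (toList g) ≡ Zcard B (dπ r π) (dg r (toList g))

_≤ᵥ_ : {n : ℕ} → Vec ℕ n → Vec ℕ n → Set
x ≤ᵥ y = Pointwise _≤_ x y

InG : List (List ℕ) → (k : ℕ) → List ℕ → ℕ → Vec ℕ (suc k) → Set
InG B k π r g = (h : Vec ℕ (suc k)) → h ≤ᵥ g →
  ¬ (Zcard B π (toList h) ≡ 0) ⊎ Zcard B (dπ r π) (dg r (toList h)) ≡ 0

IsBasisVector : List (List ℕ) → (k : ℕ) → List ℕ → ℕ → Vec ℕ (suc k) → Set
IsBasisVector B k π r b = ¬ InG B k π r b ×
  ((c : Vec ℕ (suc k)) → c ≤ᵥ b → ¬ InG B k π r c → c ≡ b)

maxLen : List (List ℕ) → ℕ
maxLen []      = 0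
maxLen (β ∷ B) = length β ⊔ maxLen B

norm : {n : ℕ} → Vec ℕ n → ℕ
norm g = sum (toList g)

module Submission where

-- Suppose ‖b‖ ≥ ‖B‖∞ for a basis vector b. Minimality of b forces Z(B;π;b) = ∅ while
-- Z(B;d_r π;d_r b) contains some q. Reinserting the value π(r) into q at its slot gives p,
-- which fits π at b; as Z(B;π;b) = ∅, p contains a pattern of B along a subsequence s,
-- and s uses π(r), for otherwise q would contain the same pattern. As |s| ≤ ‖B‖∞ ≤ ‖b‖,
-- one of the ‖b‖ values larger than k is missing from s, and it sits in a gap i of p with
-- b_i ≥ 1. Deleting it gives p′ fitting π at h = b − e_i that still contains the pattern,
-- while deleting π(r) from p′ gives an element of Z(B;d_r π;d_r h). Deleting π(r) maps
-- Z(B;π;h) injectively into Z(B;d_r π;d_r h) and misses that element, so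
-- |Z(B;π;h)| < |Z(B;d_r π;d_r h)|. But h < b lies in 𝒢_r(π), so Z(B;π;h) ≠ ∅, and
-- ES⁺-reducibility forces equality.

open import Defs
open import Data.Nat using (ℕ; zero; suc; pred; _+_; _≤_; _<_; _<?_; _≤?_; _≟_; z≤n; s≤s; >-nonZero)
open import Data.Nat.Properties
open import Data.Nat.ListAction using (sum)
open import Data.List using (List; []; _∷_; length; map; filter; take; upTo)
import Data.List.Properties as List
open import Data.List.Membership.Propositional using (_∈_; _∉_; _─_; find; lose)
open import Data.List.Membership.Propositional.Properties as List
  using (∈-map⁺; ∈-map⁻; ∈-filter⁺; ∈-filter⁻; ∈-upTo⁺; ∈-upTo⁻)
open import Data.List.Relation.Binary.Sublist.Propositional using (_⊆_; []; _∷_; _∷ʳ_; ⊆-trans)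
open import Data.List.Relation.Binary.Sublist.Propositional.Properties as Sublist
  using (filter-⊆; filter⁺; Any-resp-⊆)
open import Data.List.Membership.DecPropositional _≟_ using (_∈?_)
open import Data.List.Relation.Unary.Any using (here; there; index; any?)
open import Data.List.Relation.Unary.All as All using (All; []; _∷_)
open import Data.List.Relation.Unary.All.Properties using (¬All⇒Any¬)
open import Data.List.Relation.Unary.AllPairs using ([]; _∷_)
import Data.List.Relation.Unary.AllPairs as AllPairs
import Data.List.Relation.Unary.AllPairs.Properties as AllPairs
open import Data.List.Relation.Binary.Disjoint.Propositional using (Disjoint)
open import Data.List.Relation.Unary.Unique.DecPropositional _≟_ using (unique?)
open import Data.List.Relation.Unary.Unique.Propositional using (Unique)
import Data.List.Relation.Unary.Unique.Propositional.Properties as Unique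
open import Data.Sum using (_⊎_; inj₁; inj₂)
open import Data.Empty using (⊥; ⊥-elim)
open import Data.Vec using (Vec; toList; []; _∷_)
open import Data.Vec.Properties using (length-toList)
open import Data.Vec.Relation.Binary.Pointwise.Inductive as Pointwise using ([]; _∷_)
open import Data.Product using (∃-syntax; _×_; _,_; proj₁; proj₂)
open import Data.Maybe using (just)
import Data.Maybe as Maybe
import Data.Maybe.Properties as Maybe
open import Relation.Nullary using (¬_; Dec; yes; no; ¬?; contradiction)
open import Relation.Nullary.Decidable using (decidable-stable)
open import Relation.Binary using (tri<; tri≈; tri>)
open import Relation.Binary.PropositionalEquality
  using (_≡_; _≢_; refl; sym; trans; cong; cong₂; subst; subst₂; module ≡-Reasoning)
open import Function using (_∘_; id)

module _ {Y : Set} where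

  ∈-─⁺ : ∀ {x y : Y} {ys} (x∈ys : x ∈ ys) → y ∈ ys → y ≢ x → y ∈ ys ─ x∈ys
  ∈-─⁺ (here refl)  (here refl)  y≢x = contradiction refl y≢x
  ∈-─⁺ (here refl)  (there y∈ys) _   = y∈ys
  ∈-─⁺ (there x∈ys) (here refl)  _   = here refl
  ∈-─⁺ (there x∈ys) (there y∈ys) y≢x = there (∈-─⁺ x∈ys y∈ys y≢x)

  length-─ : ∀ {x : Y} ys (x∈ys : x ∈ ys) → length ys ≡ suc (length (ys ─ x∈ys))
  length-─ ys x∈ys = List.length-removeAt′ ys (index x∈ys)

InjectiveOn : {X Y : Set} → (X → Y) → List X → Set
InjectiveOn f xs = ∀ {a b} → a ∈ xs → b ∈ xs → f a ≡ f b → a ≡ b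

module _ {X Y : Set} (f : X → Y) where

  length-≤-injection : ∀ {xs ys} → Unique xs → InjectiveOn f xs →
                       (∀ {a} → a ∈ xs → f a ∈ ys) → length xs ≤ length ys
  length-≤-injection {[]}     _            _   _    = z≤n
  length-≤-injection {x ∷ xs} {ys} (x∉xs ∷ u) inj into = begin
    suc (length xs)           ≤⟨ s≤s (length-≤-injection u (λ a b → inj (there a) (there b)) into′) ⟩
    suc (length (ys ─ fx∈ys)) ≡⟨ length-─ ys fx∈ys ⟨
    length ys                 ∎
    where
    open ≤-Reasoning
    fx∈ys = into (here refl)
    into′ : ∀ {a} → a ∈ xs → f a ∈ ys ─ fx∈ys
    into′ a∈xs = ∈-─⁺ fx∈ys (into (there a∈xs))
      (λ fa≡fx → All.lookup x∉xs a∈xs (sym (inj (there a∈xs) (here refl) fa≡fx)))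

  length-<-injection : ∀ {xs ys y} → Unique xs → InjectiveOn f xs →
                       (∀ {a} → a ∈ xs → f a ∈ ys) → y ∈ ys → (∀ {a} → a ∈ xs → f a ≢ y) →
                       length xs < length ys
  length-<-injection {xs} {ys} u inj into y∈ys missed = begin-strict
    length xs                ≤⟨ length-≤-injection u inj (λ a∈xs → ∈-─⁺ y∈ys (into a∈xs) (missed a∈xs)) ⟩
    length (ys ─ y∈ys)       <⟨ n<1+n _ ⟩
    suc (length (ys ─ y∈ys)) ≡⟨ length-─ ys y∈ys ⟨
    length ys                ∎
    where open ≤-Reasoning

length-≤-⊆ : ∀ {X : Set} {xs ys : List X} → Unique xs → (∀ {a} → a ∈ xs → a ∈ ys) → length xs ≤ length ys
length-≤-⊆ u ⊆ = length-≤-injection id u (λ _ _ → id) ⊆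

∃∉-of-length-< : ∀ {xs ys : List ℕ} → Unique xs → length ys < length xs → ∃[ x ] x ∈ xs × x ∉ ys
∃∉-of-length-< {xs} {ys} u ys<xs with All.all? (_∈? ys) xs
... | yes xs⊆ys = contradiction (length-≤-⊆ u (All.lookup xs⊆ys)) (<⇒≱ ys<xs)
... | no  xs⊈ys = find (¬All⇒Any¬ (_∈? ys) xs xs⊈ys)

range : ℕ → List ℕ
range n = map suc (upTo n)

∈-range⁺ : ∀ {n y} → 1 ≤ y → y ≤ n → y ∈ range n
∈-range⁺ {y = suc y} _ y<n = ∈-map⁺ suc (∈-upTo⁺ y<n)

∈-range⁻ : ∀ {n y} → y ∈ range n → 1 ≤ y × y ≤ n
∈-range⁻ y∈ with _ , x∈ , refl ← ∈-map⁻ suc y∈ = s≤s z≤n , ∈-upTo⁻ x∈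

range-unique : ∀ n → Unique (range n)
range-unique n = Unique.map⁺ suc-injective (Unique.upTo⁺ n)

length-range : ∀ n → length (range n) ≡ n
length-range n = trans (List.length-map suc (upTo n)) (List.length-upTo n)

module _ {n p} (perm : IsPerm n p) where

  IsPerm-unique : Unique p
  IsPerm-unique = proj₁ (proj₂ perm)

  IsPerm-bounds : ∀ {y} → y ∈ p → 1 ≤ y × y ≤ n
  IsPerm-bounds = All.lookup (proj₂ (proj₂ perm))

  IsPerm-⊆-range : ∀ {y} → y ∈ p → y ∈ range n
  IsPerm-⊆-range y∈p = let 1≤y , y≤n = IsPerm-bounds y∈p in ∈-range⁺ 1≤y y≤n

  IsPerm-∋ : ∀ {v} → 1 ≤ v → v ≤ n → v ∈ p
  IsPerm-∋ {v} 1≤v v≤n with v ∈? p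
  ... | yes v∈p = v∈p
  ... | no  v∉p = contradiction (trans (proj₁ perm) (sym (length-range n))) (<⇒≢ p<range)
    where
    p<range : length p < length (range n)
    p<range = length-<-injection id IsPerm-unique (λ _ _ → id) IsPerm-⊆-range
      (∈-range⁺ 1≤v v≤n) (λ a∈p a≡v → v∉p (subst (_∈ p) a≡v a∈p))

  IsPerm-count-< : ∀ {x} → x ≤ n → length (filter (_<? suc x) p) ≡ x
  IsPerm-count-< {x} x≤n = ≤-antisym
    (subst (length below ≤_) (length-range x) (length-≤-⊆ (Unique.filter⁺ (_<? suc x) IsPerm-unique) below⊆range))
    (subst (_≤ length below) (length-range x) (length-≤-⊆ (range-unique x) range⊆below))
    where
    below = filter (_<? suc x) p
    below⊆range : ∀ {y} → y ∈ below → y ∈ range x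
    below⊆range y∈ = let y∈p , y≤x = ∈-filter⁻ (_<? suc x) y∈ in
      ∈-range⁺ (proj₁ (IsPerm-bounds y∈p)) (≤-pred y≤x)
    range⊆below : ∀ {y} → y ∈ range x → y ∈ below
    range⊆below y∈ = let 1≤y , y≤x = ∈-range⁻ y∈ in
      ∈-filter⁺ (_<? suc x) (IsPerm-∋ 1≤y (≤-trans y≤x x≤n)) (s≤s y≤x)

  st-IsPerm : st p ≡ p
  st-IsPerm = List.map-id-local (All.tabulate rank)
    where
    rank : ∀ {y} → y ∈ p → suc (length (filter (_<? y) p)) ≡ y
    rank {zero}  y∈p = contradiction (proj₁ (IsPerm-bounds y∈p)) λ ()
    rank {suc x} y∈p = cong suc (IsPerm-count-< (<⇒≤ (proj₂ (IsPerm-bounds y∈p))))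

-- down c renumbers the values of a permutation once the value c is removed; up c makes room for c.
down : ℕ → ℕ → ℕ
down c y with c <? y
... | yes _ = pred y
... | no  _ = y

down-> : ∀ {c y} → c < y → down c y ≡ pred y
down-> {c} {y} c<y with c <? y
... | yes _   = refl
... | no  c≮y = contradiction c<y c≮y

down-≤ : ∀ {c y} → y ≤ c → down c y ≡ y
down-≤ {c} {y} y≤c with c <? y
... | yes c<y = contradiction y≤c (<⇒≱ c<y)
... | no  _   = refl

up : ℕ → ℕ → ℕ
up c x with x <? c
... | yes _ = x
... | no  _ = suc x

up-< : ∀ {c x} → x < c → up c x ≡ x
up-< {c} {x} x<c with x <? c
... | yes _   = refl
... | no  x≮c = contradiction x<c x≮c

up-≥ : ∀ {c x} → c ≤ x → up c x ≡ suc x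
up-≥ {c} {x} c≤x with x <? c
... | yes x<c = contradiction c≤x (<⇒≱ x<c)
... | no  _   = refl

down-up : ∀ c x → down c (up c x) ≡ x
down-up c x with x <? c
... | yes x<c = down-≤ (<⇒≤ x<c)
... | no  x≮c = down-> (s≤s (≮⇒≥ x≮c))

up-down : ∀ {c y} → y ≢ c → up c (down c y) ≡ y
up-down {c} {y} y≢c with y ≤? c
... | yes y≤c = trans (cong (up c) (down-≤ y≤c)) (up-< (≤∧≢⇒< y≤c y≢c))
... | no  y≰c = let c<y = ≰⇒> y≰c in
  trans (cong (up c) (down-> c<y)) (trans (up-≥ (<⇒≤pred c<y)) (suc-pred y {{>-nonZero (≤-<-trans z≤n c<y)}}))

up-≢ : ∀ c x → up c x ≢ c
up-≢ c x up≡c with x <? c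
... | yes x<c = <-irrefl up≡c x<c
... | no  x≮c = <-irrefl (sym up≡c) (s≤s (≮⇒≥ x≮c))

down-mono-≤ : ∀ {c x y} → x ≤ y → down c x ≤ down c y
down-mono-≤ {c} {x} {y} x≤y with c <? x | c <? y
... | yes _   | yes _   = pred-mono-≤ x≤y
... | yes c<x | no  c≮y = contradiction (<-≤-trans c<x x≤y) c≮y
... | no  c≮x | yes c<y = ≤-trans (≮⇒≥ c≮x) (<⇒≤pred c<y)
... | no  _   | no  _   = x≤y

down-cancel-< : ∀ {c x y} → down c y < down c x → y < x
down-cancel-< {x = x} {y} d<d with y <? x
... | yes y<x = y<x
... | no  y≮x = contradiction (down-mono-≤ (≮⇒≥ y≮x)) (<⇒≱ d<d)

down-mono-< : ∀ {c x y} → y ≢ c → y < x → down c y < down c x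
down-mono-< {c} {x} {y} y≢c y<x with c <? y | c <? x
... | yes c<y | yes _   = pred-mono-< {{>-nonZero (≤-<-trans z≤n c<y)}} y<x
... | yes c<y | no  c≮x = contradiction (<-trans c<y y<x) c≮x
... | no  c≮y | yes c<x = <-≤-trans (≤∧≢⇒< (≮⇒≥ c≮y) y≢c) (<⇒≤pred c<x)
... | no  _   | no  _   = y<x

down-≢ : ∀ {c v x} → c < v → x ≢ c → x ≢ v → down v x ≢ c
down-≢ {c} {v} {x} c<v x≢c x≢v d≡c with x ≤? v
... | yes x≤v = x≢c (trans (sym (down-≤ x≤v)) d≡c)
... | no  x≰v = <-irrefl (sym d≡c) (subst (c <_) (sym (down-> (≰⇒> x≰v))) (<-≤-trans c<v (<⇒≤pred (≰⇒> x≰v))))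

down-≢-pred : ∀ {c v x} → c < v → x ≢ c → x ≢ v → down c x ≢ pred v
down-≢-pred {c} {v} {x} c<v x≢c x≢v d≡v with x ≤? c
... | yes x≤c = <-irrefl (trans (sym (down-≤ x≤c)) d≡v) (<-≤-trans (≤∧≢⇒< x≤c x≢c) (<⇒≤pred c<v))
... | no  x≰c = x≢v (suc-pred-injective (trans (sym (down-> (≰⇒> x≰c))) d≡v))
  where
  suc-pred-injective : pred x ≡ pred v → x ≡ v
  suc-pred-injective e = trans (sym (suc-pred x {{>-nonZero (≤-<-trans z≤n (≰⇒> x≰c))}}))
    (trans (cong suc e) (suc-pred v {{>-nonZero (≤-<-trans z≤n c<v)}}))

down-comm : ∀ {c v x} → c < v → x ≢ c → x ≢ v → down c (down v x) ≡ down (pred v) (down c x)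
down-comm {c} {v} {x} c<v x≢c x≢v with x ≤? c | x ≤? v
... | yes x≤c | yes x≤v = begin
  down c (down v x)         ≡⟨ cong (down c) (down-≤ x≤v) ⟩
  down c x                  ≡⟨ down-≤ x≤c ⟩
  x                         ≡⟨ down-≤ (≤-trans x≤c (<⇒≤pred c<v)) ⟨
  down (pred v) x           ≡⟨ cong (down (pred v)) (down-≤ x≤c) ⟨
  down (pred v) (down c x)  ∎
  where open ≡-Reasoning
... | yes x≤c | no  x≰v = contradiction (≤-trans x≤c (<⇒≤ c<v)) x≰v
... | no  x≰c | yes x≤v = begin
  down c (down v x)         ≡⟨ cong (down c) (down-≤ x≤v) ⟩
  down c x                  ≡⟨ down-> (≰⇒> x≰c) ⟩
  pred x                    ≡⟨ down-≤ (pred-mono-≤ x≤v) ⟨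
  down (pred v) (pred x)    ≡⟨ cong (down (pred v)) (down-> (≰⇒> x≰c)) ⟨
  down (pred v) (down c x)  ∎
  where open ≡-Reasoning
... | no  x≰c | no  x≰v = begin
  down c (down v x)         ≡⟨ cong (down c) (down-> v<x) ⟩
  down c (pred x)           ≡⟨ down-> (<-≤-trans c<v (<⇒≤pred v<x)) ⟩
  pred (pred x)             ≡⟨ down-> (pred-mono-< {{>-nonZero (≤-<-trans z≤n c<v)}} v<x) ⟨
  down (pred v) (pred x)    ≡⟨ cong (down (pred v)) (down-> (≰⇒> x≰c)) ⟨
  down (pred v) (down c x)  ∎
  where
  open ≡-Reasoning
  v<x = ≰⇒> x≰v

down-injective : ∀ {c x y} → x ≢ c → y ≢ c → down c x ≡ down c y → x ≡ y
down-injective {c} x≢c y≢c dx≡dy = trans (sym (up-down x≢c)) (trans (cong (up c) dx≡dy) (up-down y≢c))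

Unique-map : ∀ {X Y : Set} {f : X → Y} {xs} → InjectiveOn f xs → Unique xs → Unique (map f xs)
Unique-map {xs = []}     _   []         = []
Unique-map {f = f} {x ∷ xs} inj (x∉xs ∷ u) =
  All.tabulate fresh ∷ Unique-map (λ a b → inj (there a) (there b)) u
  where
  fresh : ∀ {z} → z ∈ map f xs → f x ≢ z
  fresh z∈ fx≡z with a , a∈xs , refl ← ∈-map⁻ f z∈ = All.lookup x∉xs a∈xs (inj (here refl) (there a∈xs) fx≡z)

_≢?_ : (x c : ℕ) → Dec (x ≢ c)
x ≢? c = ¬? (x ≟ c)

removeValue : ℕ → List ℕ → List ℕ
removeValue c = filter (_≢? c)

∈-removeValue⁻ : ∀ {c y} xs → y ∈ removeValue c xs → y ∈ xs × y ≢ c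
∈-removeValue⁻ {c} xs = ∈-filter⁻ (_≢? c) {xs = xs}

removeValue-∉ : ∀ {c xs} → c ∉ xs → removeValue c xs ≡ xs
removeValue-∉ {c} {xs} c∉xs =
  List.filter-all (_≢? c) (All.tabulate λ x∈xs x≡c → c∉xs (subst (_∈ xs) x≡c x∈xs))

removeValue-≡ : ∀ c xs → removeValue c (c ∷ xs) ≡ removeValue c xs
removeValue-≡ c xs = List.filter-reject (_≢? c) (λ c≢c → c≢c refl)

removeValue-≢ : ∀ {c x} xs → x ≢ c → removeValue c (x ∷ xs) ≡ x ∷ removeValue c xs
removeValue-≢ {c} xs = List.filter-accept (_≢? c)

length-removeValue : ∀ {c xs} → Unique xs → c ∈ xs → length xs ≡ suc (length (removeValue c xs))
length-removeValue {c} {c ∷ xs} u (here refl) =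
  cong suc (cong length (sym (trans (removeValue-≡ c xs) (removeValue-∉ (Unique.Unique[x∷xs]⇒x∉xs u)))))
length-removeValue {c} {x ∷ xs} (x∉xs ∷ u) (there c∈xs) =
  cong suc (trans (length-removeValue u c∈xs) (cong length (sym (removeValue-≢ xs (All.lookup x∉xs c∈xs)))))

deleteValue : ℕ → List ℕ → List ℕ
deleteValue c p = map (down c) (removeValue c p)

deleteValue-≡ : ∀ c xs → deleteValue c (c ∷ xs) ≡ deleteValue c xs
deleteValue-≡ c xs = cong (map (down c)) (removeValue-≡ c xs)

deleteValue-≢ : ∀ {c x} xs → x ≢ c → deleteValue c (x ∷ xs) ≡ down c x ∷ deleteValue c xs
deleteValue-≢ {c} xs x≢c = cong (map (down c)) (removeValue-≢ xs x≢c)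

up-deleteValue : ∀ c xs → map (up c) (deleteValue c xs) ≡ removeValue c xs
up-deleteValue c xs = trans (sym (List.map-∘ (removeValue c xs)))
  (List.map-id-local (All.tabulate (up-down ∘ proj₂ ∘ ∈-removeValue⁻ xs)))

deleteValue-comm : ∀ {c v} → c < v → ∀ p → deleteValue c (deleteValue v p) ≡ deleteValue (pred v) (deleteValue c p)
deleteValue-comm         c<v []      = refl
deleteValue-comm {c} {v} c<v (x ∷ p) with x ≟ v | x ≟ c
... | yes refl | _ = begin
  deleteValue c (deleteValue v (v ∷ p))
    ≡⟨ cong (deleteValue c) (deleteValue-≡ v p) ⟩
  deleteValue c (deleteValue v p)
    ≡⟨ deleteValue-comm c<v p ⟩
  deleteValue (pred v) (deleteValue c p)
    ≡⟨ deleteValue-≡ (pred v) (deleteValue c p) ⟨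
  deleteValue (pred v) (pred v ∷ deleteValue c p)
    ≡⟨ cong (λ y → deleteValue (pred v) (y ∷ deleteValue c p)) (down-> c<v) ⟨
  deleteValue (pred v) (down c v ∷ deleteValue c p)
    ≡⟨ cong (deleteValue (pred v)) (deleteValue-≢ p (λ v≡c → <-irrefl (sym v≡c) c<v)) ⟨
  deleteValue (pred v) (deleteValue c (v ∷ p)) ∎
  where open ≡-Reasoning
... | no x≢v | yes refl = begin
  deleteValue c (deleteValue v (c ∷ p))
    ≡⟨ cong (deleteValue c) (deleteValue-≢ p x≢v) ⟩
  deleteValue c (down v c ∷ deleteValue v p)
    ≡⟨ cong (λ y → deleteValue c (y ∷ deleteValue v p)) (down-≤ (<⇒≤ c<v)) ⟩
  deleteValue c (c ∷ deleteValue v p)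
    ≡⟨ deleteValue-≡ c (deleteValue v p) ⟩
  deleteValue c (deleteValue v p)
    ≡⟨ deleteValue-comm c<v p ⟩
  deleteValue (pred v) (deleteValue c p)
    ≡⟨ cong (deleteValue (pred v)) (deleteValue-≡ c p) ⟨
  deleteValue (pred v) (deleteValue c (c ∷ p)) ∎
  where open ≡-Reasoning
... | no x≢v | no x≢c = begin
  deleteValue c (deleteValue v (x ∷ p))
    ≡⟨ cong (deleteValue c) (deleteValue-≢ p x≢v) ⟩
  deleteValue c (down v x ∷ deleteValue v p)
    ≡⟨ deleteValue-≢ (deleteValue v p) (down-≢ c<v x≢c x≢v) ⟩
  down c (down v x) ∷ deleteValue c (deleteValue v p)
    ≡⟨ cong₂ _∷_ (down-comm c<v x≢c x≢v) (deleteValue-comm c<v p) ⟩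
  down (pred v) (down c x) ∷ deleteValue (pred v) (deleteValue c p)
    ≡⟨ deleteValue-≢ (deleteValue c p) (down-≢-pred c<v x≢c x≢v) ⟨
  deleteValue (pred v) (down c x ∷ deleteValue c p)
    ≡⟨ cong (deleteValue (pred v)) (deleteValue-≢ p x≢c) ⟨
  deleteValue (pred v) (deleteValue c (x ∷ p)) ∎
  where open ≡-Reasoning

deleteValue-IsPerm : ∀ {n p c} → IsPerm (suc n) p → c ∈ p → IsPerm n (deleteValue c p)
deleteValue-IsPerm {n} {p} {c} perm@(len , u , _) c∈p = length′ , unique′ , All.tabulate bounds′
  where
  length′ : length (deleteValue c p) ≡ n
  length′ = suc-injective (trans (cong suc (List.length-map (down c) (removeValue c p)))
                                 (trans (sym (length-removeValue u c∈p)) len))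
  unique′ : Unique (deleteValue c p)
  unique′ = Unique-map (λ a b → down-injective (proj₂ (∈-removeValue⁻ p a)) (proj₂ (∈-removeValue⁻ p b)))
                       (Unique.filter⁺ (_≢? c) u)
  down-bounds : ∀ {y} → y ∈ p → y ≢ c → 1 ≤ down c y × down c y ≤ n
  down-bounds {y} y∈p y≢c with y ≤? c | IsPerm-bounds perm y∈p | IsPerm-bounds perm c∈p
  ... | yes y≤c | 1≤y , _ | _ , c≤1+n rewrite down-≤ y≤c =
    1≤y , ≤-pred (<-≤-trans (≤∧≢⇒< y≤c y≢c) c≤1+n)
  ... | no  y≰c | _ , y≤1+n | 1≤c , _ rewrite down-> (≰⇒> y≰c) =
    ≤-trans 1≤c (<⇒≤pred (≰⇒> y≰c)) , pred-mono-≤ y≤1+n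
  bounds′ : ∀ {z} → z ∈ deleteValue c p → 1 ≤ z × z ≤ n
  bounds′ z∈ with y , y∈ , refl ← ∈-map⁻ (down c) z∈ =
    let y∈p , y≢c = ∈-removeValue⁻ p y∈ in down-bounds y∈p y≢c

insertAt : ℕ → ℕ → List ℕ → List ℕ
insertAt zero    x ys       = x ∷ ys
insertAt (suc i) x []       = x ∷ []
insertAt (suc i) x (y ∷ ys) = y ∷ insertAt i x ys

length-insertAt : ∀ i x ys → length (insertAt i x ys) ≡ suc (length ys)
length-insertAt zero    x ys       = refl
length-insertAt (suc i) x []       = refl
length-insertAt (suc i) x (y ∷ ys) = cong suc (length-insertAt i x ys)

All-insertAt : ∀ {P : ℕ → Set} i {x ys} → P x → All P ys → All P (insertAt i x ys)
All-insertAt zero    px pys         = px ∷ pys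
All-insertAt (suc i) px []          = px ∷ []
All-insertAt (suc i) px (py ∷ pys) = py ∷ All-insertAt i px pys

removeValue-insertAt : ∀ i {c} ys → c ∉ ys → removeValue c (insertAt i c ys) ≡ ys
removeValue-insertAt zero    {c} ys       c∉ys = trans (removeValue-≡ c ys) (removeValue-∉ c∉ys)
removeValue-insertAt (suc i) {c} []       _    = removeValue-≡ c []
removeValue-insertAt (suc i) {c} (y ∷ ys) c∉ys =
  trans (removeValue-≢ (insertAt i c ys) (λ y≡c → c∉ys (here (sym y≡c))))
        (cong (y ∷_) (removeValue-insertAt i ys (c∉ys ∘ there)))

Unique-insertAt : ∀ i {c ys} → c ∉ ys → Unique ys → Unique (insertAt i c ys)
Unique-insertAt zero    {c} {ys} c∉ys u = All.tabulate (λ y∈ys c≡y → c∉ys (subst (_∈ ys) (sym c≡y) y∈ys)) ∷ u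
Unique-insertAt (suc i) {ys = []}     _    _          = [] ∷ []
Unique-insertAt (suc i) {ys = y ∷ ys} c∉ys (y∉ys ∷ u) =
  All-insertAt i (λ y≡c → c∉ys (here (sym y≡c))) y∉ys ∷ Unique-insertAt i (c∉ys ∘ there) u

insertValue : ℕ → ℕ → List ℕ → List ℕ
insertValue i c q = insertAt i c (map (up c) q)

∉-map-up : ∀ c q → c ∉ map (up c) q
∉-map-up c q c∈ with y , _ , c≡up ← ∈-map⁻ (up c) c∈ = up-≢ c y (sym c≡up)

deleteValue-insertValue : ∀ i c q → deleteValue c (insertValue i c q) ≡ q
deleteValue-insertValue i c q = begin
  map (down c) (removeValue c (insertAt i c (map (up c) q)))
    ≡⟨ cong (map (down c)) (removeValue-insertAt i (map (up c) q) (∉-map-up c q)) ⟩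
  map (down c) (map (up c) q)
    ≡⟨ List.map-∘ q ⟨
  map (down c ∘ up c) q
    ≡⟨ List.map-cong (down-up c) q ⟩
  map id q
    ≡⟨ List.map-id q ⟩
  q ∎
  where open ≡-Reasoning

insertValue-IsPerm : ∀ {n q} i {c} → IsPerm n q → 1 ≤ c → c ≤ suc n → IsPerm (suc n) (insertValue i c q)
insertValue-IsPerm {n} {q} i {c} perm@(len , u , _) 1≤c c≤1+n =
  trans (length-insertAt i c (map (up c) q)) (cong suc (trans (List.length-map (up c) q) len)) ,
  Unique-insertAt i (∉-map-up c q) (Unique.map⁺ up-injective u) ,
  All-insertAt i (1≤c , c≤1+n) (All.tabulate bounds′)
  where
  up-injective : ∀ {x y} → up c x ≡ up c y → x ≡ y
  up-injective {x} {y} e = trans (sym (down-up c x)) (trans (cong (down c) e) (down-up c y))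
  up-bounds : ∀ {y} → y ∈ q → 1 ≤ up c y × up c y ≤ suc n
  up-bounds {y} y∈q with c ≤? y | IsPerm-bounds perm y∈q
  ... | no  c≰y | 1≤y , y≤n rewrite up-< (≰⇒> c≰y) = 1≤y , m≤n⇒m≤1+n y≤n
  ... | yes c≤y | _   , y≤n rewrite up-≥ c≤y       = s≤s z≤n , s≤s y≤n
  bounds′ : ∀ {z} → z ∈ map (up c) q → 1 ≤ z × z ≤ suc n
  bounds′ z∈ with y , y∈ , refl ← ∈-map⁻ (up c) z∈ = up-bounds y∈

at-∈ : ∀ {xs i c} → at xs i ≡ just c → c ∈ xs
at-∈ {x ∷ xs} {zero}  refl = here refl
at-∈ {x ∷ xs} {suc i} xsᵢ≡c = there (at-∈ {xs} {i} xsᵢ≡c)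

∈⇒at : ∀ {xs c} → c ∈ xs → ∃[ i ] at xs i ≡ just c
∈⇒at (here refl)  = zero , refl
∈⇒at (there c∈xs) = let i , xsᵢ≡c = ∈⇒at c∈xs in suc i , xsᵢ≡c

at-< : ∀ {xs i c} → at xs i ≡ just c → i < length xs
at-< {x ∷ xs} {zero}  _     = s≤s z≤n
at-< {x ∷ xs} {suc i} xsᵢ≡c = s≤s (at-< {xs} {i} xsᵢ≡c)

at-just : ∀ {xs i} → i < length xs → ∃[ y ] at xs i ≡ just y
at-just {x ∷ xs} {zero}  _         = x , refl
at-just {x ∷ xs} {suc i} (s≤s i<n) = at-just {xs} {i} i<n

at-map : ∀ f xs i → at (map f xs) i ≡ Maybe.map f (at xs i)
at-map f []       i       = refl
at-map f (x ∷ xs) zero    = refl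
at-map f (x ∷ xs) (suc i) = at-map f xs i

at-deleteAt-< : ∀ {xs i j} → j < i → at (deleteAt i xs) j ≡ at xs j
at-deleteAt-< {[]}                      _         = refl
at-deleteAt-< {x ∷ xs} {suc i} {zero}   _         = refl
at-deleteAt-< {x ∷ xs} {suc i} {suc j}  (s≤s j<i) = at-deleteAt-< {xs} {i} {j} j<i

at-deleteAt-≥ : ∀ {xs i j} → i ≤ j → at (deleteAt i xs) j ≡ at xs (suc j)
at-deleteAt-≥ {[]}                     _         = refl
at-deleteAt-≥ {x ∷ xs} {zero}          _         = refl
at-deleteAt-≥ {x ∷ xs} {suc i} {suc j} (s≤s i≤j) = at-deleteAt-≥ {xs} {i} {j} i≤j

length-deleteAt : ∀ {xs i} → i < length xs → length xs ≡ suc (length (deleteAt i xs))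
length-deleteAt {x ∷ xs} {zero}  _         = refl
length-deleteAt {x ∷ xs} {suc i} (s≤s i<n) = cong suc (length-deleteAt {xs} {i} i<n)

deleteAt-removeValue : ∀ {xs i c} → Unique xs → at xs i ≡ just c → deleteAt i xs ≡ removeValue c xs
deleteAt-removeValue {c ∷ xs} {zero}  {c} u refl =
  sym (trans (removeValue-≡ c xs) (removeValue-∉ (Unique.Unique[x∷xs]⇒x∉xs u)))
deleteAt-removeValue {x ∷ xs} {suc i} {c} (x∉xs ∷ u) xsᵢ≡c =
  trans (cong (x ∷_) (deleteAt-removeValue u xsᵢ≡c))
        (sym (removeValue-≢ xs (All.lookup x∉xs (at-∈ {xs} {i} xsᵢ≡c))))

deleteAt-injective : ∀ {xs ys i c} → at xs i ≡ just c → at ys i ≡ just c → deleteAt i xs ≡ deleteAt i ys → xs ≡ ys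
deleteAt-injective {x ∷ xs} {y ∷ ys} {zero}  refl refl e = cong (x ∷_) e
deleteAt-injective {x ∷ xs} {y ∷ ys} {suc i} xsᵢ≡c ysᵢ≡c e =
  cong₂ _∷_ (List.∷-injectiveˡ e) (deleteAt-injective xsᵢ≡c ysᵢ≡c (List.∷-injectiveʳ e))

deleteValue-injective : ∀ {a a′ i c} → Unique a → Unique a′ → at a i ≡ just c → at a′ i ≡ just c →
                        deleteValue c a ≡ deleteValue c a′ → a ≡ a′
deleteValue-injective {a} {a′} {i} {c} u u′ aᵢ≡c a′ᵢ≡c e = deleteAt-injective aᵢ≡c a′ᵢ≡c (begin
  deleteAt i a                  ≡⟨ deleteAt-removeValue u aᵢ≡c ⟩
  removeValue c a               ≡⟨ up-deleteValue c a ⟨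
  map (up c) (deleteValue c a)  ≡⟨ cong (map (up c)) e ⟩
  map (up c) (deleteValue c a′) ≡⟨ up-deleteValue c a′ ⟩
  removeValue c a′              ≡⟨ deleteAt-removeValue u′ a′ᵢ≡c ⟨
  deleteAt i a′                 ∎)
  where open ≡-Reasoning

at-insertAt-< : ∀ {i x ys j} → j < i → i ≤ length ys → at (insertAt i x ys) j ≡ at ys j
at-insertAt-< {suc i} {x} {y ∷ ys} {zero}  _         _         = refl
at-insertAt-< {suc i} {x} {y ∷ ys} {suc j} (s≤s j<i) (s≤s i≤n) = at-insertAt-< {i} {x} {ys} {j} j<i i≤n

at-insertAt-≡ : ∀ {i x ys} → i ≤ length ys → at (insertAt i x ys) i ≡ just x
at-insertAt-≡ {zero}              _         = refl
at-insertAt-≡ {suc i} {x} {y ∷ ys} (s≤s i≤n) = at-insertAt-≡ {i} {x} {ys} i≤n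

at-insertAt-> : ∀ {i x ys j} → i < j → at (insertAt i x ys) j ≡ at ys (pred j)
at-insertAt-> {zero}              {j = suc j}       _         = refl
at-insertAt-> {suc i} {x} {[]}     {suc zero}    (s≤s ())
at-insertAt-> {suc i} {x} {[]}     {suc (suc j)} _         = refl
at-insertAt-> {suc i} {x} {y ∷ ys} {suc (suc j)} (s≤s i<j) = at-insertAt-> {i} {x} {ys} {suc j} i<j

∈-subseqs⁻ : ∀ {s} p → s ∈ subseqs p → s ⊆ p
∈-subseqs⁻ []      (here refl) = []
∈-subseqs⁻ (x ∷ p) s∈ with List.∈-++⁻ (map (x ∷_) (subseqs p)) s∈
... | inj₂ s∈′ = x ∷ʳ ∈-subseqs⁻ p s∈′
... | inj₁ s∈′ with t , t∈ , refl ← ∈-map⁻ (x ∷_) s∈′ = refl ∷ ∈-subseqs⁻ p t∈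

∈-subseqs⁺ : ∀ {s p} → s ⊆ p → s ∈ subseqs p
∈-subseqs⁺ []                  = here refl
∈-subseqs⁺ {p = y ∷ p} (y ∷ʳ τ) = List.∈-++⁺ʳ (map (y ∷_) (subseqs p)) (∈-subseqs⁺ τ)
∈-subseqs⁺ (refl ∷ τ)          = List.∈-++⁺ˡ (∈-map⁺ _ (∈-subseqs⁺ τ))

Contains⁻ : ∀ {β} p → Contains p β → ∃[ s ] s ⊆ p × st s ≡ β
Contains⁻ p con = let s , s∈ , st≡β = find con in s , ∈-subseqs⁻ p s∈ , st≡β

Contains⁺ : ∀ {s p} → s ⊆ p → Contains p (st s)
Contains⁺ τ = lose (∈-subseqs⁺ τ) refl

map-⊆⁻ : ∀ (f : ℕ → ℕ) {s′} w → s′ ⊆ map f w → ∃[ s ] s ⊆ w × s′ ≡ map f s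
map-⊆⁻ f []      []         = [] , [] , refl
map-⊆⁻ f (x ∷ w) (_ ∷ʳ τ)   with s , τ′ , refl ← map-⊆⁻ f w τ = s , x ∷ʳ τ′ , refl
map-⊆⁻ f (x ∷ w) (refl ∷ τ) with s , τ′ , refl ← map-⊆⁻ f w τ = x ∷ s , refl ∷ τ′ , refl

count-<-map : ∀ f x s → (∀ {y} → y ∈ s → (y < x → f y < f x) × (f y < f x → y < x)) →
              length (filter (_<? f x) (map f s)) ≡ length (filter (_<? x) s)
count-<-map f x []      _  = refl
count-<-map f x (y ∷ s) op with y <? x | f y <? f x
... | yes y<x | yes fy<fx = begin
  length (filter (_<? f x) (map f (y ∷ s))) ≡⟨ cong length (List.filter-accept (_<? f x) fy<fx) ⟩
  suc (length (filter (_<? f x) (map f s))) ≡⟨ cong suc (count-<-map f x s (op ∘ there)) ⟩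
  suc (length (filter (_<? x) s))           ≡⟨ cong length (List.filter-accept (_<? x) y<x) ⟨
  length (filter (_<? x) (y ∷ s))           ∎
  where open ≡-Reasoning
... | yes y<x | no  fy≮fx = contradiction (proj₁ (op (here refl)) y<x) fy≮fx
... | no  y≮x | yes fy<fx = contradiction (proj₂ (op (here refl)) fy<fx) y≮x
... | no  y≮x | no  fy≮fx = begin
  length (filter (_<? f x) (map f (y ∷ s))) ≡⟨ cong length (List.filter-reject (_<? f x) fy≮fx) ⟩
  length (filter (_<? f x) (map f s))       ≡⟨ count-<-map f x s (op ∘ there) ⟩
  length (filter (_<? x) s)                 ≡⟨ cong length (List.filter-reject (_<? x) y≮x) ⟨
  length (filter (_<? x) (y ∷ s))           ∎
  where open ≡-Reasoning

st-map : ∀ f s → (∀ {x y} → x ∈ s → y ∈ s → (y < x → f y < f x) × (f y < f x → y < x)) → st (map f s) ≡ st s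
st-map f s op = trans (sym (List.map-∘ s))
  (List.map-cong-local (All.tabulate λ {x} x∈s → cong suc (count-<-map f x s (op x∈s))))

st-down : ∀ {c s} → All (_≢ c) s → st (map (down c) s) ≡ st s
st-down {c} {s} s≢c = st-map (down c) s (λ _ y∈s → down-mono-< (All.lookup s≢c y∈s) , down-cancel-<)

Contains-deleteValue⁻ : ∀ {c w β} → Contains (deleteValue c w) β → Contains w β
Contains-deleteValue⁻ {c} {w} {β} con = subst (Contains w) st≡β (Contains⁺ (⊆-trans τ (filter-⊆ (_≢? c) w)))
  where
  s′∈ = Contains⁻ (deleteValue c w) con
  s∈ = map-⊆⁻ (down c) (removeValue c w) (proj₁ (proj₂ s′∈))
  s = proj₁ s∈
  τ : s ⊆ removeValue c w
  τ = proj₁ (proj₂ s∈)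
  s≢c : All (_≢ c) s
  s≢c = All.tabulate λ y∈s → proj₂ (∈-removeValue⁻ w (Any-resp-⊆ τ y∈s))
  st≡β : st s ≡ β
  st≡β = trans (sym (st-down s≢c)) (trans (cong st (sym (proj₂ (proj₂ s∈)))) (proj₂ (proj₂ s′∈)))

Avoids-deleteValue : ∀ {c w B} → Avoids w B → Avoids (deleteValue c w) B
Avoids-deleteValue {c} {w} = All.map (λ w∌β → w∌β ∘ Contains-deleteValue⁻ {c} {w})

Contains-deleteValue⁺ : ∀ {c s p} → s ⊆ p → c ∉ s → Contains (deleteValue c p) (st s)
Contains-deleteValue⁺ {c} {s} {p} τ c∉s =
  subst (Contains (deleteValue c p)) (st-down s≢c) (Contains⁺ (Sublist.map⁺ (down c) τ′))
  where
  s≢c : All (_≢ c) s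
  s≢c = All.tabulate λ y∈s y≡c → c∉s (subst (_∈ s) y≡c y∈s)
  τ′ : s ⊆ removeValue c p
  τ′ = subst (_⊆ removeValue c p) (removeValue-∉ c∉s) (filter⁺ (_≢? c) (_≢? c) (λ { refl → id }) τ)

st-deleteAt : ∀ {n π i c} → IsPerm (suc n) π → at π i ≡ just c → st (deleteAt i π) ≡ deleteValue c π
st-deleteAt {π = π} {i} {c} perm@(_ , u , _) πᵢ≡c = begin
  st (deleteAt i π)                   ≡⟨ cong st (deleteAt-removeValue u πᵢ≡c) ⟩
  st (removeValue c π)                ≡⟨ st-down (All.tabulate (proj₂ ∘ ∈-removeValue⁻ π)) ⟨
  st (deleteValue c π)                ≡⟨ st-IsPerm (deleteValue-IsPerm perm (at-∈ {π} {i} πᵢ≡c)) ⟩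
  deleteValue c π                     ∎
  where open ≡-Reasoning

prefixSum : ℕ → List ℕ → ℕ
prefixSum j g = sum (take j g)

entry : List ℕ → ℕ → ℕ
entry []      _       = 0
entry (x ∷ g) zero    = x
entry (x ∷ g) (suc i) = entry g i

-- the 0-indexed position that Fits prescribes for π(i + 1)
slot : List ℕ → ℕ → ℕ
slot g i = prefixSum (suc i) g + i

prefixSum-[] : ∀ j → prefixSum j [] ≡ 0
prefixSum-[] zero    = refl
prefixSum-[] (suc j) = refl

prefixSum-suc : ∀ i g → prefixSum (suc i) g ≡ prefixSum i g + entry g i
prefixSum-suc i       []      = sym (trans (+-identityʳ _) (prefixSum-[] i))
prefixSum-suc zero    (x ∷ g) = +-identityʳ x
prefixSum-suc (suc i) (x ∷ g) = trans (cong (x +_) (prefixSum-suc i g)) (sym (+-assoc x _ _))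

prefixSum-mono : ∀ g {i j} → i ≤ j → prefixSum i g ≤ prefixSum j g
prefixSum-mono []      {i} {j} _         = ≤-reflexive (trans (prefixSum-[] i) (sym (prefixSum-[] j)))
prefixSum-mono (x ∷ g) {zero}          _         = z≤n
prefixSum-mono (x ∷ g) {suc i} {suc j} (s≤s i≤j) = +-monoʳ-≤ x (prefixSum-mono g i≤j)

prefixSum-≤-sum : ∀ j g → prefixSum j g ≤ sum g
prefixSum-≤-sum zero    g       = z≤n
prefixSum-≤-sum (suc j) []      = z≤n
prefixSum-≤-sum (suc j) (x ∷ g) = +-monoʳ-≤ x (prefixSum-≤-sum j g)

slot-mono-< : ∀ g {i j} → i < j → slot g i < slot g j
slot-mono-< g i<j = +-mono-≤-< (prefixSum-mono g (s≤s (<⇒≤ i<j))) i<j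

prefixSum-mergeAt-≤ : ∀ r j g → j ≤ r → prefixSum j (mergeAt r g) ≡ prefixSum j g
prefixSum-mergeAt-≤ r       zero    g       _         = refl
prefixSum-mergeAt-≤ (suc r) (suc j) []      _         = refl
prefixSum-mergeAt-≤ (suc r) (suc j) (x ∷ g) (s≤s j≤r) = cong (x +_) (prefixSum-mergeAt-≤ r j g j≤r)

prefixSum-mergeAt-> : ∀ r j g → r < j → prefixSum j (mergeAt r g) ≡ prefixSum (suc j) g
prefixSum-mergeAt-> zero    (suc j) []          _         = refl
prefixSum-mergeAt-> zero    (suc j) (x ∷ [])    _         = cong (x +_) (trans (prefixSum-[] j) (sym (prefixSum-[] (suc j))))
prefixSum-mergeAt-> zero    (suc j) (x ∷ y ∷ g) _         = +-assoc x y (prefixSum j g)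
prefixSum-mergeAt-> (suc r) (suc j) []          _         = refl
prefixSum-mergeAt-> (suc r) (suc j) (x ∷ g)     (s≤s r<j) = cong (x +_) (prefixSum-mergeAt-> r j g r<j)

sum-mergeAt : ∀ r g → sum (mergeAt r g) ≡ sum g
sum-mergeAt zero    []          = refl
sum-mergeAt zero    (x ∷ [])    = refl
sum-mergeAt zero    (x ∷ y ∷ g) = +-assoc x y (sum g)
sum-mergeAt (suc r) []          = refl
sum-mergeAt (suc r) (x ∷ g)     = cong (x +_) (sum-mergeAt r g)

decrementAt : ℕ → List ℕ → List ℕ
decrementAt _       []      = []
decrementAt zero    (x ∷ g) = pred x ∷ g
decrementAt (suc i) (x ∷ g) = x ∷ decrementAt i g

prefixSum-decrementAt-≤ : ∀ i j g → j ≤ i → prefixSum j (decrementAt i g) ≡ prefixSum j g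
prefixSum-decrementAt-≤ i       zero    g       _         = refl
prefixSum-decrementAt-≤ (suc i) (suc j) []      _         = refl
prefixSum-decrementAt-≤ (suc i) (suc j) (x ∷ g) (s≤s j≤i) = cong (x +_) (prefixSum-decrementAt-≤ i j g j≤i)

prefixSum-decrementAt-> : ∀ i j g → i < j → 1 ≤ entry g i → suc (prefixSum j (decrementAt i g)) ≡ prefixSum j g
prefixSum-decrementAt-> zero    (suc j) (suc x ∷ g) _         _   = refl
prefixSum-decrementAt-> (suc i) (suc j) (x ∷ g)     (s≤s i<j) gᵢ≥1 =
  trans (sym (+-suc x _)) (cong (x +_) (prefixSum-decrementAt-> i j g i<j gᵢ≥1))

sum-decrementAt : ∀ i g → 1 ≤ entry g i → suc (sum (decrementAt i g)) ≡ sum g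
sum-decrementAt zero    (suc x ∷ g) _    = refl
sum-decrementAt (suc i) (x ∷ g)     gᵢ≥1 = trans (sym (+-suc x _)) (cong (x +_) (sum-decrementAt i g gᵢ≥1))

-- j is one of the g_{i+1} free positions just before slot i
InGap : List ℕ → ℕ → ℕ → Set
InGap g i j = prefixSum i g + i ≤ j × j < slot g i

InGap⇒entry-≥1 : ∀ g i {j} → InGap g i j → 1 ≤ entry g i
InGap⇒entry-≥1 g i {j} (lo , hi) with entry g i in gᵢ≡
... | suc _ = s≤s z≤n
... | zero  = contradiction (<-≤-trans (subst (j <_) slot≡ hi) lo) (<-irrefl refl)
  where
  slot≡ : slot g i ≡ prefixSum i g + i
  slot≡ = cong (_+ i) (trans (prefixSum-suc i g) (trans (cong (prefixSum i g +_) gᵢ≡) (+-identityʳ _)))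

gap-block : ∀ k g j → length g ≡ suc k → j < sum g + k → (∀ i → i < k → j ≢ slot g i) → ∃[ i ] InGap g i j
gap-block k g j len j<end j∉slots = search k 0 (+-identityʳ k) z≤n
  where
  search : ∀ d m → d + m ≡ k → prefixSum m g + m ≤ j → ∃[ i ] InGap g i j
  search zero    m refl lo = m , lo , subst (λ s → j < s + m) (sym (cong sum (List.take-all (suc m) g (≤-reflexive len)))) j<end
  search (suc d) m d+m≡k lo with j <? slot g m
  ... | yes j<slot = m , lo , j<slot
  ... | no  j≮slot = search d (suc m) (trans (+-suc d m) d+m≡k)
    (subst (_≤ j) (sym (+-suc (prefixSum (suc m) g) m))
      (≤∧≢⇒< (≮⇒≥ j≮slot) (j∉slots m (subst (m <_) d+m≡k (m<n+m m (s≤s z≤n))) ∘ sym)))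

-- Fits in pointwise form, wrapped in a record so that π, g and p can be inferred
record FitsAt (π g p : List ℕ) : Set where
  field fits-at : ∀ {i} → i < length π → at p (slot g i) ≡ at π i
open FitsAt public

Fits⇒FitsAt : ∀ {π g p} → Fits π g p → FitsAt π g p
Fits⇒FitsAt fits .fits-at i<n = All.lookup fits (∈-upTo⁺ i<n)

FitsAt⇒Fits : ∀ {π g p} → FitsAt π g p → Fits π g p
FitsAt⇒Fits fits = All.tabulate (fits-at fits ∘ ∈-upTo⁻)

FitsAt-map : ∀ f {π g p} → FitsAt π g p → FitsAt (map f π) g (map f p)
FitsAt-map f {π} {g} {p} fits .fits-at {i} i<n = begin
  at (map f p) (slot g i)
    ≡⟨ at-map f p (slot g i) ⟩
  Maybe.map f (at p (slot g i))
    ≡⟨ cong (Maybe.map f) (fits-at fits (subst (i <_) (List.length-map f π) i<n)) ⟩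
  Maybe.map f (at π i)
    ≡⟨ at-map f π i ⟨
  at (map f π) i ∎
  where open ≡-Reasoning

FitsAt-deleteAt : ∀ {π g p} r → r < length π → FitsAt π g p →
                  FitsAt (deleteAt r π) (mergeAt r g) (deleteAt (slot g r) p)
FitsAt-deleteAt {π} {g} {p} r r<n fits .fits-at {i} i<n′ with i <? r
... | yes i<r = begin
  at (deleteAt (slot g r) p) (slot (mergeAt r g) i)
    ≡⟨ cong (λ s → at (deleteAt (slot g r) p) (s + i)) (prefixSum-mergeAt-≤ r (suc i) g i<r) ⟩
  at (deleteAt (slot g r) p) (slot g i)
    ≡⟨ at-deleteAt-< {p} (slot-mono-< g i<r) ⟩
  at p (slot g i)
    ≡⟨ fits-at fits (<-trans i<r r<n) ⟩
  at π i
    ≡⟨ at-deleteAt-< {π} i<r ⟨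
  at (deleteAt r π) i ∎
  where open ≡-Reasoning
... | no i≮r = begin
  at (deleteAt (slot g r) p) (slot (mergeAt r g) i)
    ≡⟨ cong (λ s → at (deleteAt (slot g r) p) (s + i)) (prefixSum-mergeAt-> r (suc i) g (s≤s r≤i)) ⟩
  at (deleteAt (slot g r) p) (prefixSum (suc (suc i)) g + i)
    ≡⟨ at-deleteAt-≥ {p} (+-mono-≤ (prefixSum-mono g (s≤s (m≤n⇒m≤1+n r≤i))) r≤i) ⟩
  at p (suc (prefixSum (suc (suc i)) g + i))
    ≡⟨ cong (at p) (+-suc _ i) ⟨
  at p (slot g (suc i))
    ≡⟨ fits-at fits (subst (suc i <_) (sym (length-deleteAt {π} {r} r<n)) (s≤s i<n′)) ⟩
  at π (suc i)
    ≡⟨ at-deleteAt-≥ {π} r≤i ⟨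
  at (deleteAt r π) i ∎
  where
  open ≡-Reasoning
  r≤i = ≮⇒≥ i≮r

FitsAt-insertAt : ∀ {π g q c} r → at π r ≡ just c → slot g r ≤ length q →
                  FitsAt (deleteAt r π) (mergeAt r g) q → FitsAt π g (insertAt (slot g r) c q)
FitsAt-insertAt {π} {g} {q} {c} r πᵣ≡c r≤n fits .fits-at {i} i<n with <-cmp i r
... | tri< i<r _ _ = begin
  at (insertAt (slot g r) c q) (slot g i)
    ≡⟨ at-insertAt-< (slot-mono-< g i<r) r≤n ⟩
  at q (slot g i)
    ≡⟨ cong (λ s → at q (s + i)) (prefixSum-mergeAt-≤ r (suc i) g i<r) ⟨
  at q (slot (mergeAt r g) i)
    ≡⟨ fits-at fits (<-≤-trans i<r (≤-pred (subst (r <_) (length-deleteAt {π} {r} r<n) r<n))) ⟩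
  at (deleteAt r π) i
    ≡⟨ at-deleteAt-< {π} i<r ⟩
  at π i ∎
  where
  open ≡-Reasoning
  r<n = at-< {π} {r} πᵣ≡c
... | tri≈ _ refl _ = trans (at-insertAt-≡ r≤n) (sym πᵣ≡c)
FitsAt-insertAt {π} {g} {q} {c} r πᵣ≡c r≤n fits .fits-at {suc i} i<n | tri> _ _ (s≤s r≤i) = begin
  at (insertAt (slot g r) c q) (slot g (suc i))
    ≡⟨ at-insertAt-> (slot-mono-< g (s≤s r≤i)) ⟩
  at q (pred (slot g (suc i)))
    ≡⟨ cong (at q) (cong pred (+-suc _ i)) ⟩
  at q (prefixSum (suc (suc i)) g + i)
    ≡⟨ cong (λ s → at q (s + i)) (prefixSum-mergeAt-> r (suc i) g (s≤s r≤i)) ⟨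
  at q (slot (mergeAt r g) i)
    ≡⟨ fits-at fits (≤-pred (subst (suc i <_) (length-deleteAt {π} {r} (at-< {π} {r} πᵣ≡c)) i<n)) ⟩
  at (deleteAt r π) i
    ≡⟨ at-deleteAt-≥ {π} r≤i ⟩
  at π (suc i) ∎
  where open ≡-Reasoning

FitsAt-deleteGap : ∀ {π g p i j} → InGap g i j → FitsAt π g p → FitsAt π (decrementAt i g) (deleteAt j p)
FitsAt-deleteGap {π} {g} {p} {i} {j} gap@(lo , hi) fits .fits-at {i′} i′<n with i′ <? i
... | yes i′<i = begin
  at (deleteAt j p) (slot (decrementAt i g) i′)
    ≡⟨ cong (λ s → at (deleteAt j p) (s + i′)) (prefixSum-decrementAt-≤ i (suc i′) g i′<i) ⟩
  at (deleteAt j p) (slot g i′)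
    ≡⟨ at-deleteAt-< {p} (<-≤-trans (+-mono-≤-< (prefixSum-mono g i′<i) i′<i) lo) ⟩
  at p (slot g i′)
    ≡⟨ fits-at fits i′<n ⟩
  at π i′ ∎
  where open ≡-Reasoning
... | no i′≮i = begin
  at (deleteAt j p) (D + i′) ≡⟨ at-deleteAt-≥ {p} j≤D+i′ ⟩
  at p (suc D + i′)          ≡⟨ cong (λ s → at p (s + i′)) 1+D≡ ⟩
  at p (slot g i′)           ≡⟨ fits-at fits i′<n ⟩
  at π i′                    ∎
  where
  open ≡-Reasoning
  i≤i′ = ≮⇒≥ i′≮i
  D = prefixSum (suc i′) (decrementAt i g)
  1+D≡ : suc D ≡ prefixSum (suc i′) g
  1+D≡ = prefixSum-decrementAt-> i (suc i′) g (s≤s i≤i′) (InGap⇒entry-≥1 g i gap)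
  j≤D+i′ : j ≤ D + i′
  j≤D+i′ = ≤-pred (<-≤-trans hi (subst (slot g i ≤_) (cong (_+ i′) (sym 1+D≡))
                                   (+-mono-≤ (prefixSum-mono g (s≤s i≤i′)) i≤i′)))

map-down-deleteAt : ∀ {xs i c} → Unique xs → at xs i ≡ just c → map (down c) (deleteAt i xs) ≡ deleteValue c xs
map-down-deleteAt {c = c} u xsᵢ≡c = cong (map (down c)) (deleteAt-removeValue u xsᵢ≡c)

FitsAt-deleteValue : ∀ {π g p r c} → Unique π → Unique p → at π r ≡ just c → FitsAt π g p →
                     FitsAt (deleteValue c π) (mergeAt r g) (deleteValue c p)
FitsAt-deleteValue {π} {g} {p} {r} {c} uπ up πᵣ≡c fits =
  subst₂ (λ π′ p′ → FitsAt π′ (mergeAt r g) p′)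
    (map-down-deleteAt {π} uπ πᵣ≡c) (map-down-deleteAt {p} up (trans (fits-at fits r<n) πᵣ≡c))
    (FitsAt-map (down c) (FitsAt-deleteAt r r<n fits))
  where r<n = at-< {π} {r} πᵣ≡c

FitsAt-insertValue : ∀ {π g q r c} → Unique π → at π r ≡ just c → slot g r ≤ length q →
                     FitsAt (deleteValue c π) (mergeAt r g) q → FitsAt π g (insertValue (slot g r) c q)
FitsAt-insertValue {π} {g} {q} {r} {c} uπ πᵣ≡c r≤n fits =
  FitsAt-insertAt r πᵣ≡c (subst (slot g r ≤_) (sym (List.length-map (up c) q)) r≤n)
    (subst (λ π′ → FitsAt π′ (mergeAt r g) (map (up c) q)) up-π⁻ (FitsAt-map (up c) fits))
  where
  up-π⁻ : map (up c) (deleteValue c π) ≡ deleteAt r π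
  up-π⁻ = trans (up-deleteValue c π) (sym (deleteAt-removeValue uπ πᵣ≡c))

FitsAt-deleteLarge : ∀ {π g p i j v} → All (_≤ v) π → Unique p → at p j ≡ just v → InGap g i j →
                     FitsAt π g p → FitsAt π (decrementAt i g) (deleteValue v p)
FitsAt-deleteLarge {π} {g} {p} {i} {j} {v} π≤v up pⱼ≡v gap fits =
  subst₂ (λ π′ p′ → FitsAt π′ (decrementAt i g) p′)
    (List.map-id-local (All.map down-≤ π≤v)) (map-down-deleteAt {p} up pⱼ≡v)
    (FitsAt-map (down v) (FitsAt-deleteGap gap fits))

words-complete : ∀ n xs w → length w ≡ n → All (_∈ xs) w → w ∈ words n xs
words-complete zero    xs []      refl []            = here refl
words-complete (suc n) xs (x ∷ w) refl (x∈xs ∷ w⊆xs) =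
  List.∈-concatMap⁺ (λ x → map (x ∷_) (words n xs)) (lose x∈xs (∈-map⁺ (x ∷_) (words-complete n xs w refl w⊆xs)))

words-sound : ∀ n xs w → w ∈ words n xs → length w ≡ n × All (_∈ xs) w
words-sound zero    xs w (here refl) = refl , []
words-sound (suc n) xs w w∈
  with x , x∈xs , w∈block ← find (List.∈-concatMap⁻ (λ x → map (x ∷_) (words n xs)) {xs = xs} w∈)
  with w′ , w′∈ , refl ← ∈-map⁻ (x ∷_) w∈block =
  let len , w′⊆xs = words-sound n xs w′ w′∈ in cong suc len , x∈xs ∷ w′⊆xs

words-unique : ∀ n {xs} → Unique xs → Unique (words n xs)
words-unique zero    _ = [] ∷ []
words-unique (suc n) {xs} u =
  Unique.concat⁺ (All.tabulate block-unique) (AllPairs.map⁺ (AllPairs.map blocks-disjoint u))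
  where
  block : ℕ → List (List ℕ)
  block x = map (x ∷_) (words n xs)
  block-unique : ∀ {ws} → ws ∈ map block xs → Unique ws
  block-unique ws∈ with x , _ , refl ← ∈-map⁻ block ws∈ = Unique.map⁺ List.∷-injectiveʳ (words-unique n u)
  blocks-disjoint : ∀ {x y} → x ≢ y → Disjoint (block x) (block y)
  blocks-disjoint x≢y (w∈x , w∈y) with _ , _ , refl ← ∈-map⁻ _ w∈x | _ , _ , x∷≡y∷ ← ∈-map⁻ _ w∈y =
    x≢y (List.∷-injectiveˡ x∷≡y∷)

∈-allPerms⁺ : ∀ {n p} → IsPerm n p → p ∈ allPerms n
∈-allPerms⁺ {n} {p} perm@(len , u , _) =
  ∈-filter⁺ unique? (words-complete n (range n) p len (All.tabulate (IsPerm-⊆-range perm))) u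

∈-allPerms⁻ : ∀ {n p} → p ∈ allPerms n → IsPerm n p
∈-allPerms⁻ {n} {p} p∈ with p∈words , u ← ∈-filter⁻ unique? {xs = words n (range n)} p∈
                        with len , p⊆range ← words-sound n (range n) p p∈words =
  len , u , All.map ∈-range⁻ p⊆range

allPerms-unique : ∀ n → Unique (allPerms n)
allPerms-unique n = Unique.filter⁺ unique? (words-unique n (range-unique n))

Zlist : List (List ℕ) → List ℕ → List ℕ → List (List ℕ)
Zlist B π g = filter (InZ? B π g) (allPerms (length π + sum g))

∈-Zlist⁺ : ∀ B π g {p} → IsPerm (length π + sum g) p → InZ B π g p → p ∈ Zlist B π g
∈-Zlist⁺ B π g perm = ∈-filter⁺ (InZ? B π g) (∈-allPerms⁺ perm)

∈-Zlist⁻ : ∀ B π g {p} → p ∈ Zlist B π g → IsPerm (length π + sum g) p × InZ B π g p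
∈-Zlist⁻ B π g p∈ = let p∈perms , p∈Z = ∈-filter⁻ (InZ? B π g) {xs = allPerms (length π + sum g)} p∈ in
  ∈-allPerms⁻ p∈perms , p∈Z

Zcard≢0⇒∃ : ∀ B π g → Zcard B π g ≢ 0 → ∃[ p ] p ∈ Zlist B π g
Zcard≢0⇒∃ B π g Z≢0 with Zlist B π g
... | []    = contradiction refl Z≢0
... | p ∷ _ = p , here refl

length≡0⇒∉ : ∀ {X : Set} {x : X} {xs} → length xs ≡ 0 → x ∉ xs
length≡0⇒∉ {xs = []}    _  ()
length≡0⇒∉ {xs = _ ∷ _} () _

maxLen-≥ : ∀ {B β} → β ∈ B → length β ≤ maxLen B
maxLen-≥ {β ∷ B} (here refl) = m≤m⊔n (length β) (maxLen B)
maxLen-≥ {γ ∷ B} (there β∈B) = ≤-trans (maxLen-≥ β∈B) (m≤n⊔m (length γ) (maxLen B))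

Contains? : ∀ p β → Dec (Contains p β)
Contains? p β = any? (λ s → List.≡-dec _≟_ (st s) β) (subseqs p)

¬Avoids⇒Contains : ∀ {p B} → ¬ Avoids p B → ∃[ β ] β ∈ B × Contains p β
¬Avoids⇒Contains {p} {B} ¬avoids =
  let β , β∈B , ¬¬contains = find (¬All⇒Any¬ (λ β → ¬? (Contains? p β)) B ¬avoids) in
  β , β∈B , decidable-stable (Contains? p β) ¬¬contains

largeValues : ℕ → ℕ → List ℕ
largeValues k m = map (k +_) (range m)

∈-largeValues⁻ : ∀ {k m v} → v ∈ largeValues k m → k < v × v ≤ k + m
∈-largeValues⁻ {k} v∈ with t , t∈ , refl ← ∈-map⁻ (k +_) v∈ =
  let 1≤t , t≤m = ∈-range⁻ t∈ in m<m+n k 1≤t , +-monoʳ-≤ k t≤m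

Unique-∷-largeValues : ∀ {c k m} → c ≤ k → Unique (c ∷ largeValues k m)
Unique-∷-largeValues {c} {k} {m} c≤k =
  All.tabulate (λ y∈ c≡y → <-irrefl c≡y (≤-<-trans c≤k (proj₁ (∈-largeValues⁻ y∈))))
  ∷ Unique.map⁺ (+-cancelˡ-≡ k _ _) (range-unique m)

large-value-∉ : ∀ {c k m s} → c ≤ k → c ∈ s → length s ≤ m → ∃[ v ] (k < v × v ≤ k + m) × v ∉ s
large-value-∉ {c} {k} {m} {s} c≤k c∈s s≤m
  with ∃∉-of-length-< (Unique-∷-largeValues {m = m} c≤k)
         (s≤s (subst (length s ≤_) (sym (trans (List.length-map (k +_) (range m)) (length-range m))) s≤m))
... | _ , here refl , c∉s = contradiction c∈s c∉s
... | v , there v∈ , v∉s = v , ∈-largeValues⁻ v∈ , v∉s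

gap-of-large-value : ∀ {k π g p j v} → length π ≡ k → All (_≤ k) π → length g ≡ suc k → FitsAt π g p →
                     length p ≡ k + sum g → k < v → at p j ≡ just v → ∃[ i ] InGap g i j
gap-of-large-value {k} {π} {g} {p} {j} {v} lenπ π≤k leng fits lenp k<v pⱼ≡v =
  gap-block k g j leng (subst (j <_) (trans lenp (+-comm k (sum g))) (at-< {p} {j} pⱼ≡v)) not-slot
  where
  not-slot : ∀ i → i < k → j ≢ slot g i
  not-slot i i<k j≡slot with y , πᵢ≡y ← at-just {π} {i} (subst (i <_) (sym lenπ) i<k) =
    <-irrefl (sym v≡y) (≤-<-trans (All.lookup π≤k (at-∈ {π} {i} πᵢ≡y)) k<v)
    where
    v≡y : v ≡ y
    v≡y = Maybe.just-injective (trans (sym pⱼ≡v) (trans (cong (at p) j≡slot)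
            (trans (fits-at fits (subst (i <_) (sym lenπ) i<k)) πᵢ≡y)))

-- Here r is 0-indexed: π⁻ is d_{r+1}(π) (see st-deleteAt) and mergeAt r is d_{r+1} on gap vectors.
module Reduction (B : List (List ℕ)) {n π} (π-perm : IsPerm (suc n) π) {r c} (πᵣ≡c : at π r ≡ just c) where

  π⁻ : List ℕ
  π⁻ = deleteValue c π

  private
    π-unique : Unique π
    π-unique = IsPerm-unique π-perm

    r<π : r < length π
    r<π = at-< {π} {r} πᵣ≡c

    c-bounds : 1 ≤ c × c ≤ suc n
    c-bounds = IsPerm-bounds π-perm (at-∈ {π} {r} πᵣ≡c)

    dim : ∀ g → suc (n + sum g) ≡ length π + sum g
    dim g = cong (_+ sum g) (sym (proj₁ π-perm))

    dim⁻ : ∀ g → n + sum g ≡ length π⁻ + sum (mergeAt r g)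
    dim⁻ g = sym (cong₂ _+_ (proj₁ (deleteValue-IsPerm π-perm (at-∈ {π} {r} πᵣ≡c))) (sum-mergeAt r g))

    c-at-slot : ∀ {g a} → FitsAt π g a → at a (slot g r) ≡ just c
    c-at-slot fits = trans (fits-at fits r<π) πᵣ≡c

  deleteValue-reduces : ∀ {g a} → IsPerm (length π + sum g) a → FitsAt π g a →
                        IsPerm (length π⁻ + sum (mergeAt r g)) (deleteValue c a) × FitsAt π⁻ (mergeAt r g) (deleteValue c a)
  deleteValue-reduces {g} {a} perm fits =
    subst (λ m → IsPerm m (deleteValue c a)) (dim⁻ g)
          (deleteValue-IsPerm (subst (λ m → IsPerm m a) (sym (dim g)) perm) (at-∈ {a} (c-at-slot fits))) ,
    FitsAt-deleteValue π-unique (IsPerm-unique perm) πᵣ≡c fits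

  deleteValue-∈Zlist : ∀ {g a} → a ∈ Zlist B π g → deleteValue c a ∈ Zlist B π⁻ (mergeAt r g)
  deleteValue-∈Zlist {g} {a} a∈ with perm , avoids , fits ← ∈-Zlist⁻ B π g a∈
                        with perm⁻ , fits⁻ ← deleteValue-reduces perm (Fits⇒FitsAt fits) =
    ∈-Zlist⁺ B π⁻ (mergeAt r g) perm⁻ (Avoids-deleteValue {c} {a} avoids , FitsAt⇒Fits fits⁻)

  Zcard-< : ∀ {g p} → IsPerm (length π + sum g) p → FitsAt π g p → ¬ Avoids p B →
            deleteValue c p ∈ Zlist B π⁻ (mergeAt r g) → Zcard B π g < Zcard B π⁻ (mergeAt r g)
  Zcard-< {g} {p} p-perm p-fits p-contains p⁻∈ =
    length-<-injection (deleteValue c) {Zlist B π g} {Zlist B π⁻ (mergeAt r g)}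
      (Unique.filter⁺ (InZ? B π g) (allPerms-unique (length π + sum g)))
      (λ a∈ a′∈ → let perm′ , _ , fits′ = ∈-Zlist⁻ B π g a′∈ in
                  same-reduction a∈ (IsPerm-unique perm′) (Fits⇒FitsAt fits′))
      (deleteValue-∈Zlist {g}) p⁻∈ missed
    where
    same-reduction : ∀ {a a′} → a ∈ Zlist B π g → Unique a′ → FitsAt π g a′ →
                     deleteValue c a ≡ deleteValue c a′ → a ≡ a′
    same-reduction {a} a∈ u′ fits′ =
      let perm , _ , fits = ∈-Zlist⁻ B π g a∈ in
      deleteValue-injective (IsPerm-unique perm) u′ (c-at-slot (Fits⇒FitsAt {π} {g} {a} fits)) (c-at-slot fits′)
    missed : ∀ {a} → a ∈ Zlist B π g → deleteValue c a ≢ deleteValue c p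
    missed a∈ e with refl ← same-reduction a∈ (IsPerm-unique p-perm) p-fits e =
      let _ , a-avoids , _ = ∈-Zlist⁻ B π g a∈ in p-contains a-avoids

  insertValue-lifts : ∀ {g q} → IsPerm (length π⁻ + sum (mergeAt r g)) q → FitsAt π⁻ (mergeAt r g) q →
                      IsPerm (suc (n + sum g)) (insertValue (slot g r) c q) × FitsAt π g (insertValue (slot g r) c q)
  insertValue-lifts {g} {q} perm fits =
    insertValue-IsPerm (slot g r) perm′ (proj₁ c-bounds) (≤-trans (proj₂ c-bounds) (s≤s (m≤m+n n (sum g)))) ,
    FitsAt-insertValue π-unique πᵣ≡c slot≤q fits
    where
    perm′ : IsPerm (n + sum g) q
    perm′ = subst (λ m → IsPerm m q) (sym (dim⁻ g)) perm
    slot≤q : slot g r ≤ length q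
    slot≤q = subst (slot g r ≤_) (trans (+-comm (sum g) n) (sym (proj₁ perm′)))
      (+-mono-≤ (prefixSum-≤-sum (suc r) g) (≤-pred (subst (r <_) (proj₁ π-perm) r<π)))

  DeficientBelow : List ℕ → Set
  DeficientBelow g = ∃[ i ] 1 ≤ entry g i × Zcard B π (decrementAt i g) < Zcard B π⁻ (mergeAt r (decrementAt i g))

  delete-large-value : ∀ {g p s v} → length g ≡ suc (suc n) → IsPerm (suc (n + sum g)) p → FitsAt π g p →
                       Avoids (deleteValue c p) B → s ⊆ p → st s ∈ B → v ∉ s → suc n < v → v ≤ suc (n + sum g) →
                       DeficientBelow g
  delete-large-value {g} {p} {s} {v} len p-perm p-fits p⁻-avoids τ st∈B v∉s n<v v≤ =
    i , gᵢ≥1 , Zcard-< p′-perm p′-fits p′-contains p′⁻∈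
    where
    v∈p : v ∈ p
    v∈p = IsPerm-∋ p-perm (≤-trans (s≤s z≤n) n<v) v≤
    π≤1+n : All (_≤ suc n) π
    π≤1+n = All.tabulate (proj₂ ∘ IsPerm-bounds π-perm)
    j = proj₁ (∈⇒at v∈p)
    pⱼ≡v : at p j ≡ just v
    pⱼ≡v = proj₂ (∈⇒at v∈p)
    gap = gap-of-large-value (proj₁ π-perm) π≤1+n len p-fits (proj₁ p-perm) n<v pⱼ≡v
    i = proj₁ gap
    gᵢ≥1 : 1 ≤ entry g i
    gᵢ≥1 = InGap⇒entry-≥1 g i (proj₂ gap)
    h = decrementAt i g
    p′ = deleteValue v p
    p′-perm : IsPerm (length π + sum h) p′
    p′-perm = subst (λ m → IsPerm m p′)
      (trans (cong (n +_) (sym (sum-decrementAt i g gᵢ≥1))) (trans (+-suc n (sum h)) (dim h)))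
      (deleteValue-IsPerm p-perm v∈p)
    p′-fits : FitsAt π h p′
    p′-fits = FitsAt-deleteLarge (All.map (λ y≤1+n → ≤-trans y≤1+n (<⇒≤ n<v)) π≤1+n)
                                 (IsPerm-unique p-perm) pⱼ≡v (proj₂ gap) p-fits
    p′-contains : ¬ Avoids p′ B
    p′-contains avoids = All.lookup avoids st∈B (Contains-deleteValue⁺ τ v∉s)
    p′⁻-avoids : Avoids (deleteValue c p′) B
    p′⁻-avoids = subst (λ w → Avoids w B) (sym (deleteValue-comm (≤-<-trans (proj₂ c-bounds) n<v) p))
                       (Avoids-deleteValue {pred v} {deleteValue c p} p⁻-avoids)
    p′⁻∈ : deleteValue c p′ ∈ Zlist B π⁻ (mergeAt r h)
    p′⁻∈ = let perm⁻ , fits⁻ = deleteValue-reduces p′-perm p′-fits in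
      ∈-Zlist⁺ B π⁻ (mergeAt r h) perm⁻ (p′⁻-avoids , FitsAt⇒Fits fits⁻)

  occurrence⇒DeficientBelow : ∀ {g p s} → length g ≡ suc (suc n) → IsPerm (suc (n + sum g)) p → FitsAt π g p →
                       Avoids (deleteValue c p) B → s ⊆ p → st s ∈ B → length s ≤ sum g → DeficientBelow g
  occurrence⇒DeficientBelow {s = s} len p-perm p-fits p⁻-avoids τ st∈B s≤g with c ∈? s
  ... | no  c∉s = contradiction (Contains-deleteValue⁺ τ c∉s) (All.lookup p⁻-avoids st∈B)
  ... | yes c∈s with v , (n<v , v≤) , v∉s ← large-value-∉ (proj₂ c-bounds) c∈s s≤g =
    delete-large-value len p-perm p-fits p⁻-avoids τ st∈B v∉s n<v v≤

  deficientBelow : ∀ g → length g ≡ suc (suc n) → Zcard B π g ≡ 0 → Zcard B π⁻ (mergeAt r g) ≢ 0 →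
           maxLen B ≤ sum g → DeficientBelow g
  deficientBelow g len Z≡0 Z⁻≢0 B≤g =
    let q , q∈                     = Zcard≢0⇒∃ B π⁻ (mergeAt r g) Z⁻≢0
        q-perm , q-avoids , q-fits = ∈-Zlist⁻ B π⁻ (mergeAt r g) q∈
        p-perm , p-fits            = insertValue-lifts q-perm (Fits⇒FitsAt q-fits)
        p                          = insertValue (slot g r) c q
        p⁻-avoids                  = subst (λ w → Avoids w B) (sym (deleteValue-insertValue (slot g r) c q)) q-avoids
        p-contains : ¬ Avoids p B
        p-contains avoids          = length≡0⇒∉ Z≡0
          (∈-Zlist⁺ B π g (subst (λ m → IsPerm m p) (dim g) p-perm) (avoids , FitsAt⇒Fits p-fits))
        β , β∈B , p∋β              = ¬Avoids⇒Contains {p} {B} p-contains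
        s , τ , st≡β               = Contains⁻ p p∋β
        st∈B                       = subst (_∈ B) (sym st≡β) β∈B
        s≤g                        = ≤-trans (≤-reflexive (sym (List.length-map _ s))) (≤-trans (maxLen-≥ {B} st∈B) B≤g)
    in  occurrence⇒DeficientBelow {g} {p} {s} len p-perm p-fits p⁻-avoids τ st∈B s≤g

decrementAtᵥ : ∀ {m} → ℕ → Vec ℕ m → Vec ℕ m
decrementAtᵥ _       []      = []
decrementAtᵥ zero    (x ∷ v) = pred x ∷ v
decrementAtᵥ (suc i) (x ∷ v) = x ∷ decrementAtᵥ i v

toList-decrementAtᵥ : ∀ {m} i (v : Vec ℕ m) → toList (decrementAtᵥ i v) ≡ decrementAt i (toList v)
toList-decrementAtᵥ _       []      = refl
toList-decrementAtᵥ zero    (x ∷ v) = refl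
toList-decrementAtᵥ (suc i) (x ∷ v) = cong (x ∷_) (toList-decrementAtᵥ i v)

decrementAtᵥ-≤ : ∀ {m} i (v : Vec ℕ m) → decrementAtᵥ i v ≤ᵥ v
decrementAtᵥ-≤ _       []      = []
decrementAtᵥ-≤ zero    (x ∷ v) = pred[n]≤n ∷ Pointwise.refl ≤-refl
decrementAtᵥ-≤ (suc i) (x ∷ v) = ≤-refl ∷ decrementAtᵥ-≤ i v

decrementAtᵥ-≢ : ∀ {m} i (v : Vec ℕ m) → 1 ≤ entry (toList v) i → decrementAtᵥ i v ≢ v
decrementAtᵥ-≢ i v vᵢ≥1 e = <-irrefl (cong norm e) (begin-strict
  norm (decrementAtᵥ i v)              ≡⟨ cong sum (toList-decrementAtᵥ i v) ⟩
  sum (decrementAt i (toList v))       <⟨ n<1+n _ ⟩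
  suc (sum (decrementAt i (toList v))) ≡⟨ sum-decrementAt i (toList v) vᵢ≥1 ⟩
  norm v                               ∎)
  where open ≤-Reasoning

InG-at-self : ∀ {B k π r h} → InG B k π r h → Zcard B π (toList h) ≢ 0 ⊎ Zcard B (dπ r π) (dg r (toList h)) ≡ 0
InG-at-self {h = h} h∈G = h∈G h (Pointwise.refl ≤-refl)

witness-∉G : ∀ {B k π r h} → Zcard B π (toList h) ≡ 0 → Zcard B (dπ r π) (dg r (toList h)) ≢ 0 → ¬ InG B k π r h
witness-∉G {B} {k} {π} {r} {h} Z≡0 Z⁻≢0 h∈G with InG-at-self {B} {k} {π} {r} {h} h∈G
... | inj₁ Z≢0  = Z≢0 Z≡0
... | inj₂ Z⁻≡0 = Z⁻≢0 Z⁻≡0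

reducible-∈G⇒¬< : ∀ {B k π r h} → ESReducible B k π r → InG B k π r h →
                  ¬ Zcard B π (toList h) < Zcard B (dπ r π) (dg r (toList h))
reducible-∈G⇒¬< {B} {k} {π} {r} {h} reducible h∈G Z<Z⁻ with InG-at-self {B} {k} {π} {r} {h} h∈G
... | inj₁ Z≢0  = <-irrefl (reducible h Z≢0) Z<Z⁻
... | inj₂ Z⁻≡0 = contradiction (subst (_ <_) Z⁻≡0 Z<Z⁻) λ ()

mainTheorem3 : (B : List (List ℕ)) → All IsPermutation B →
    (k : ℕ) (π : List ℕ) → IsPerm k π →
    (r : ℕ) → 1 ≤ r → r ≤ k →
    ESReducible B k π r →
    (b : Vec ℕ (suc k)) → IsBasisVector B k π r b →
    norm b + 1 ≤ maxLen B
mainTheorem3 B _ (suc n) π π-perm (suc r) _ (s≤s r≤n) reducible b (b∉G , b-minimal) with norm b + 1 ≤? maxLen B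
... | yes b<B = b<B
... | no  b≮B = contradiction b∈G b∉G
  where
  c-at-r = at-just {π} {r} (subst (r <_) (sym (proj₁ π-perm)) (s≤s r≤n))
  open Reduction B π-perm (proj₂ c-at-r)
  dπ≡π⁻ : dπ (suc r) π ≡ π⁻
  dπ≡π⁻ = st-deleteAt π-perm (proj₂ c-at-r)
  b-not-witness : Zcard B π (toList b) ≡ 0 → Zcard B π⁻ (mergeAt r (toList b)) ≢ 0 → ⊥
  b-not-witness Z≡0 Z⁻≢0 = smaller-violates
    (deficientBelow (toList b) (length-toList b) Z≡0 Z⁻≢0 (≤-pred (subst (maxLen B <_) (+-comm (norm b) 1) (≰⇒> b≮B))))
    where
    smaller-violates : DeficientBelow (toList b) → ⊥
    smaller-violates (i , bᵢ≥1 , Z<Z⁻) =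
      decrementAtᵥ-≢ i b bᵢ≥1 (b-minimal (decrementAtᵥ i b) (decrementAtᵥ-≤ i b) λ h∈G →
        reducible-∈G⇒¬< {B} {suc n} {π} {suc r} {decrementAtᵥ i b} reducible h∈G
          (subst₂ (λ π′ h → Zcard B π h < Zcard B π′ (mergeAt r h))
                  (sym dπ≡π⁻) (sym (toList-decrementAtᵥ i b)) Z<Z⁻))
  b∈G : InG B (suc n) π (suc r) b
  b∈G h h≤b with Zcard B (dπ (suc r) π) (mergeAt r (toList h)) ≟ 0 | Zcard B π (toList h) ≟ 0
  ... | yes Z⁻≡0 | _       = inj₂ Z⁻≡0
  ... | no  _    | no  Z≢0 = inj₁ Z≢0
  ... | no  Z⁻≢0 | yes Z≡0 with refl ← b-minimal h h≤b (witness-∉G {B} {suc n} {π} {suc r} {h} Z≡0 Z⁻≢0) =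
    ⊥-elim (b-not-witness Z≡0 (subst (λ π′ → Zcard B π′ (mergeAt r (toList b)) ≢ 0) dπ≡π⁻ Z⁻≢0))
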